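{- Let $\mathcal{L}=\{l_1, l_2, \dots, l_s\}$ be a set of $s$ nonnegative integers with $0 \leq l_{1} < l_{2} < \cdots < l_{s}$. Suppose that $\mathcal{A} = \{A_1, A_2, \dots, A_{m}\}$ is a family of subsets of $[n]=\{1,\dots,n\}$ such that (i) $|A_{i} \cap A_{j}| \in \mathcal{L}$ for all $i \neq j$, and (ii) $|A_{i}| \notin \mathcal{L}$ for every $1 \leq i \leq m$. Then \[|\mathcal{A}|\leq \binom{n - 1}{s} + \binom{n - 1}{s - 1} + \cdots + \binom{n - 1}{0}.\] -}

module Defs where

open import Data.Nat using (ℕ; zero; suc; _+_; _∸_; _<_)
open import Data.Nat.Combinatorics using (_C_)
open import Data.Fin using (Fin)
open import Data.Product using (∃)
open import Relation.Binary.PropositionalEquality using (_≡_)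

binomSum : ℕ → ℕ → ℕ
binomSum N zero    = N C 0
binomSum N (suc s) = binomSum N s + N C (suc s)

_∈L_ : ℕ → {s : ℕ} → (Fin s → ℕ) → Set
x ∈L L = ∃ λ k → x ≡ L k

StrictlyIncreasing : {s : ℕ} → (Fin s → ℕ) → Set
StrictlyIncreasing {s} L = ∀ (i j : Fin s) → Data.Fin._<_ i j → L i < L j

{-# OPTIONS --safe #-}
-- Write each set as A = x ∷ v, where x records whether A contains the first point and
-- v ⊆ [n − 1] is the rest, and put f_A(u) = ∏ₜ (⟨v, u⟩ + x − lₜ) for u ∈ {0,1}^(n−1).
-- Since u² = u there, f_A is a multilinear polynomial of degree ≤ s, and these span a space
-- of dimension C(n−1,0) + ⋯ + C(n−1,s). When x_A ≤ x_B, ⟨v_A, v_B⟩ + x_A = |A ∩ B|, so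
-- f_A(v_A) = ∏ₜ (|A| − lₜ) ≠ 0 by (ii) and f_A(v_B) = ∏ₜ (|A ∩ B| − lₜ) = 0 by (i) if A ≠ B.
-- Thus a linear relation among the f_A has zero coefficients, first at the sets containing
-- the first point and then at all others: the coefficient vectors of the f_A are linearly
-- independent, and fraction-free Gaussian elimination bounds their number by the dimension.
module Submission where

open import Defs
open import Data.Nat as ℕ using (ℕ; zero; suc; _≤_; _<_; _∸_; s≤s)
import Data.Nat.Properties as ℕ
open import Data.Nat.Combinatorics using (_C_; nCk+nC[k+1]≡[n+1]C[k+1])
open import Data.Nat.Tactic.RingSolver as ℕ-Solver using ()
open import Data.Fin using (Fin; zero; suc; punchIn; splitAt)
open import Data.Fin.Properties using (all?; ¬∀⟶∃¬; punchInᵢ≢i)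
open import Data.Fin.Subset using (Subset; _∩_; ∣_∣)
open import Data.Fin.Subset.Properties using (∩-idem)
open import Data.Bool using (Bool; true; false; f≤t; b≤b) renaming (_≤_ to _≤ᴮ_)
open import Data.Bool.Properties using (≤-refl; ≤-maximum; ≤-minimum)
open import Data.Integer using (ℤ; 0ℤ; 1ℤ; +_; _+_; _*_; _-_; -_; _≟_)
open import Data.Integer.Properties
  using (+-*-semiring; *-1-monoid; +-identityˡ; +-identityʳ; +-assoc; +-inverseʳ; +-injective;
         i-j≡0⇒i≡j; *-identityʳ; *-zeroˡ; *-zeroʳ; *-comm; i*j≡0⇒i≡0∨j≡0)
open import Data.Integer.Tactic.RingSolver using (solve-∀)
open import Data.Vec using (Vec; []; _∷_)
import Data.Vec as Vec
open import Data.Vec.Functional using (Vector; _++_; insertAt; tail; map; replicate)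
open import Data.Vec.Functional.Properties using (insertAt-lookup; insertAt-punchIn)
open import Algebra.Properties.Semiring.Sum +-*-semiring
  using (sum; sum-syntax; sum-cong-≗; sum-replicate-zero; sum-remove; ∑-distrib-+; ∑-comm;
         *-distribˡ-sum; *-distribʳ-sum)
open import Algebra.Properties.Monoid.Sum *-1-monoid
  using () renaming (sum to product; sum-cong-≗ to product-cong-≗)
open import Data.Sum using (_⊎_; inj₁; inj₂; [_,_]′)
open import Data.Sum.Properties using ([,]-map)
open import Data.Product using (∃; _×_; _,_)
open import Data.Empty using (⊥-elim)
open import Function using (_∘_; id)
open import Function.Definitions using (Injective)
open import Relation.Nullary using (¬_; yes; no)
open import Relation.Binary.PropositionalEquality
open ≡-Reasoning

private variable k d m n s D : ℕ

sum-zero : {xs : Vector ℤ n} → (∀ i → xs i ≡ 0ℤ) → sum xs ≡ 0ℤ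
sum-zero {n} xs≡0 = trans (sum-cong-≗ xs≡0) (sum-replicate-zero n)

sum-++ : (xs : Vector ℤ m) (ys : Vector ℤ n) → sum (xs ++ ys) ≡ sum xs + sum ys
sum-++ {zero}  xs ys = sym (+-identityˡ (sum ys))
sum-++ {suc m} xs ys = begin
  xs zero + sum (tail (xs ++ ys))     ≡⟨ cong (_+_ (xs zero)) (sum-cong-≗ ([,]-map ∘ splitAt m)) ⟩
  xs zero + sum (tail xs ++ ys)       ≡⟨ cong (_+_ (xs zero)) (sum-++ (tail xs) ys) ⟩
  xs zero + (sum (tail xs) + sum ys)  ≡⟨ +-assoc (xs zero) _ _ ⟨
  xs zero + sum (tail xs) + sum ys    ∎

sum≡0⇒coefficient≡0 : ∀ (κ a : Vector ℤ m) j → ∑[ i < m ] (κ i * a i) ≡ 0ℤ → a j ≢ 0ℤ →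
                      (∀ i → i ≢ j → κ i * a i ≡ 0ℤ) → κ j ≡ 0ℤ
sum≡0⇒coefficient≡0 {suc m} κ a j sum≡0 aⱼ≢0 others≡0 =
  [ id , ⊥-elim ∘ aⱼ≢0 ]′ (i*j≡0⇒i≡0∨j≡0 (κ j) κⱼaⱼ≡0)
  where
  κⱼaⱼ≡0 : κ j * a j ≡ 0ℤ
  κⱼaⱼ≡0 = begin
    κ j * a j
      ≡⟨ +-identityʳ (κ j * a j) ⟨
    κ j * a j + 0ℤ
      ≡⟨ cong (_+_ (κ j * a j)) (sum-zero λ i → others≡0 (punchIn j i) (punchInᵢ≢i j i)) ⟨
    κ j * a j + ∑[ i < m ] (κ (punchIn j i) * a (punchIn j i))
      ≡⟨ sum-remove {i = j} (λ i → κ i * a i) ⟨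
    ∑[ i < suc m ] (κ i * a i)
      ≡⟨ sum≡0 ⟩
    0ℤ
      ∎

product≡0 : ∀ (xs : Vector ℤ s) i → xs i ≡ 0ℤ → product xs ≡ 0ℤ
product≡0 xs zero    xsᵢ≡0 =
  trans (cong (_* product (tail xs)) xsᵢ≡0) (*-zeroˡ (product (tail xs)))
product≡0 xs (suc i) xsᵢ≡0 =
  trans (cong (xs zero *_) (product≡0 (tail xs) i xsᵢ≡0)) (*-zeroʳ (xs zero))

product≢0 : ∀ (xs : Vector ℤ s) → (∀ i → xs i ≢ 0ℤ) → product xs ≢ 0ℤ
product≢0 {zero}  xs _    ()
product≢0 {suc s} xs xs≢0 ∏≡0 with i*j≡0⇒i≡0∨j≡0 (xs zero) ∏≡0
... | inj₁ head≡0 = xs≢0 zero head≡0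
... | inj₂ rest≡0 = product≢0 (tail xs) (xs≢0 ∘ suc) rest≡0

dot : Vector ℤ D → Vector ℤ D → ℤ
dot {D} xs ys = ∑[ t < D ] (xs t * ys t)

dot-++ : (xs zs : Vector ℤ m) (ys ws : Vector ℤ n) → dot (xs ++ ys) (zs ++ ws) ≡ dot xs zs + dot ys ws
dot-++ {m} xs zs ys ws =
  trans (sum-cong-≗ ++-pointwise) (sum-++ (λ t → xs t * zs t) (λ t → ys t * ws t))
  where
  ++-pointwise : ∀ t → (xs ++ ys) t * (zs ++ ws) t ≡ ((λ t → xs t * zs t) ++ (λ t → ys t * ws t)) t
  ++-pointwise t with splitAt m t
  ... | inj₁ _ = refl
  ... | inj₂ _ = refl

dot-*ʳ : ∀ a (xs ys : Vector ℤ D) → dot xs (map (a *_) ys) ≡ a * dot xs ys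
dot-*ʳ a xs ys = begin
  dot xs (map (a *_) ys)         ≡⟨ sum-cong-≗ (λ t → x*[a*y]≡a*[x*y] a (xs t) (ys t)) ⟩
  sum (λ t → a * (xs t * ys t))  ≡⟨ *-distribˡ-sum a (λ t → xs t * ys t) ⟨
  a * dot xs ys                  ∎
  where
  x*[a*y]≡a*[x*y] : ∀ a x y → x * (a * y) ≡ a * (x * y)
  x*[a*y]≡a*[x*y] = solve-∀

combination : Vector ℤ m → (Fin m → Vector ℤ D) → Vector ℤ D
combination {m} κ c t = ∑[ i < m ] (κ i * c i t)

∑-dot≡dot-combination : ∀ (κ : Vector ℤ m) (c : Fin m → Vector ℤ D) e →
                        ∑[ i < m ] (κ i * dot (c i) e) ≡ dot (combination κ c) e
∑-dot≡dot-combination {m} {D} κ c e = begin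
  ∑[ i < m ] (κ i * dot (c i) e)
    ≡⟨ sum-cong-≗ (λ i → *-distribˡ-sum (κ i) (λ t → c i t * e t)) ⟩
  ∑[ i < m ] ∑[ t < D ] (κ i * (c i t * e t))
    ≡⟨ ∑-comm (λ i t → κ i * (c i t * e t)) ⟩
  ∑[ t < D ] ∑[ i < m ] (κ i * (c i t * e t))
    ≡⟨ sum-cong-≗ (λ t → sum-cong-≗ λ i → reassoc (κ i) (c i t) (e t)) ⟩
  ∑[ t < D ] ∑[ i < m ] (κ i * c i t * e t)
    ≡⟨ sum-cong-≗ (λ t → *-distribʳ-sum (e t) (λ i → κ i * c i t)) ⟨
  dot (combination κ c) e
    ∎
  where
  reassoc : ∀ k x y → k * (x * y) ≡ k * x * y
  reassoc = solve-∀

LinearlyDependent : (Fin m → Vector ℤ D) → Set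
LinearlyDependent c = ∃ λ κ → (∃ λ i → κ i ≢ 0ℤ) × (∀ t → combination κ c t ≡ 0ℤ)

LinearlyIndependent : (Fin m → Vector ℤ D) → Set
LinearlyIndependent c = ∀ κ → (∀ t → combination κ c t ≡ 0ℤ) → ∀ i → κ i ≡ 0ℤ

dependent-zeroColumn : (c : Fin m → Vector ℤ (suc D)) → (∀ i → c i zero ≡ 0ℤ) →
                       LinearlyDependent (tail ∘ c) → LinearlyDependent c
dependent-zeroColumn c column≡0 (κ , nontrivial , combination≡0) = κ , nontrivial , λ where
  zero    → sum-zero (λ i → trans (cong (κ i *_) (column≡0 i)) (*-zeroʳ (κ i)))
  (suc t) → combination≡0 t

-- Fraction-free elimination of coordinate 0 with pivot row i: a relation κ among the
-- eliminated rows lifts to the relation pivotCoefficients i c κ among the rows of c.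
eliminate : Fin (suc m) → (Fin (suc m) → Vector ℤ (suc D)) → Fin m → Vector ℤ (suc D)
eliminate i c j t = c i zero * c (punchIn i j) t - c (punchIn i j) zero * c i t

pivotCoefficients : Fin (suc m) → (Fin (suc m) → Vector ℤ (suc D)) → Vector ℤ m → Vector ℤ (suc m)
pivotCoefficients {m} i c κ = insertAt (map (c i zero *_) κ) i (- ∑[ j < m ] (κ j * c (punchIn i j) zero))

combination-pivotCoefficients : ∀ (i : Fin (suc m)) (c : Fin (suc m) → Vector ℤ (suc D)) κ t →
                                combination (pivotCoefficients i c κ) c t ≡ combination κ (eliminate i c) t
combination-pivotCoefficients {m} i c κ t = begin
  combination κ′ c t
    ≡⟨ sum-remove {i = i} (λ i′ → κ′ i′ * c i′ t) ⟩
  κ′ i * c i t + ∑[ j < m ] (κ′ (punchIn i j) * r j t)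
    ≡⟨ cong₂ (λ a b → a * c i t + b) (insertAt-lookup _ i _)
             (sum-cong-≗ λ j → cong (_* r j t) (insertAt-punchIn _ i _ j)) ⟩
  - S * c i t + ∑[ j < m ] (h * κ j * r j t)
    ≡⟨ cong (_+_ (- S * c i t)) (sum-cong-≗ λ j → split h (κ j) (r j t) (r j zero) (c i t)) ⟩
  - S * c i t + ∑[ j < m ] (E j + κ j * r j zero * c i t)
    ≡⟨ cong (_+_ (- S * c i t)) (∑-distrib-+ E _) ⟩
  - S * c i t + (sum E + ∑[ j < m ] (κ j * r j zero * c i t))
    ≡⟨ cong (λ x → - S * c i t + (sum E + x)) (*-distribʳ-sum (c i t) (λ j → κ j * r j zero)) ⟨
  - S * c i t + (sum E + S * c i t)
    ≡⟨ cancel S (c i t) (sum E) ⟩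
  sum E
    ∎
  where
  κ′ = pivotCoefficients i c κ
  h = c i zero
  r = c ∘ punchIn i
  S = ∑[ j < m ] (κ j * r j zero)
  E : Vector ℤ m
  E j = κ j * eliminate i c j t
  split : ∀ h k x x₀ y → h * k * x ≡ k * (h * x - x₀ * y) + k * x₀ * y
  split = solve-∀
  cancel : ∀ s x e → - s * x + (e + s * x) ≡ e
  cancel = solve-∀

dependent-pivot : (c : Fin (suc m) → Vector ℤ (suc D)) (i : Fin (suc m)) → c i zero ≢ 0ℤ →
                  LinearlyDependent (tail ∘ eliminate i c) → LinearlyDependent c
dependent-pivot c i pivot≢0 (κ , (j , κⱼ≢0) , combination≡0) =
  pivotCoefficients i c κ , (punchIn i j , nontrivial) ,
  λ t → trans (combination-pivotCoefficients i c κ t) (eliminated t)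
  where
  nontrivial : pivotCoefficients i c κ (punchIn i j) ≢ 0ℤ
  nontrivial eq with i*j≡0⇒i≡0∨j≡0 (c i zero) (trans (sym (insertAt-punchIn _ i _ j)) eq)
  ... | inj₁ pivot≡0 = pivot≢0 pivot≡0
  ... | inj₂ κⱼ≡0    = κⱼ≢0 κⱼ≡0
  eliminated : ∀ t → combination κ (eliminate i c) t ≡ 0ℤ
  eliminated zero    = sum-zero λ j → pivot-cancels (κ j) (c i zero) (c (punchIn i j) zero)
    where
    pivot-cancels : ∀ k a b → k * (a * b - b * a) ≡ 0ℤ
    pivot-cancels = solve-∀
  eliminated (suc t) = combination≡0 t

dim<size⇒dependent : D < m → (c : Fin m → Vector ℤ D) → LinearlyDependent c
dim<size⇒dependent {zero}  {suc m} _ c = (λ _ → 1ℤ) , (zero , λ ()) , λ ()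
dim<size⇒dependent {suc D} {suc m} (s≤s D<m) c with all? (λ i → c i zero ≟ 0ℤ)
... | yes column≡0 =
  dependent-zeroColumn c column≡0 (dim<size⇒dependent (ℕ.m<n⇒m<1+n D<m) (tail ∘ c))
... | no column≢0 with ¬∀⟶∃¬ _ _ (λ i → c i zero ≟ 0ℤ) column≢0
...   | i , pivot≢0 = dependent-pivot c i pivot≢0 (dim<size⇒dependent D<m (tail ∘ eliminate i c))

independent⇒size≤dim : (c : Fin m → Vector ℤ D) → LinearlyIndependent c → m ≤ D
independent⇒size≤dim {m} {D} c independent with m ℕ.≤? D
... | yes m≤D = m≤D
... | no m≰D with dim<size⇒dependent (ℕ.≰⇒> m≰D) c
...   | κ , (i , κᵢ≢0) , combination≡0 = ⊥-elim (κᵢ≢0 (independent κ combination≡0 i))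

toℤ : Bool → ℤ
toℤ false = 0ℤ
toℤ true  = 1ℤ

toℤ-idem : ∀ x → toℤ x * toℤ x ≡ toℤ x
toℤ-idem false = refl
toℤ-idem true  = refl

-- Multilinear polynomials of degree ≤ d in k variables ranging over {0,1}: p +x· q is
-- p(u) + x q(u) in the variables x ∷ u. Constants exist at every index, so the
-- representation is not unique.
infixl 6 _+x·_ _⊕_
infixr 7 _·_

data Poly : ℕ → ℕ → Set where
  const : ℤ → Poly k d
  _+x·_ : Poly k (suc d) → Poly k d → Poly (suc k) (suc d)

eval : Poly k d → Vec Bool k → ℤ
eval (const c) u       = c
eval (p +x· q) (x ∷ u) = eval p u + toℤ x * eval q u

_⊕_ : Poly k d → Poly k d → Poly k d
const a     ⊕ const b     = const (a + b)
const a     ⊕ (q₀ +x· q₁) = (const a ⊕ q₀) +x· q₁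
(p₀ +x· p₁) ⊕ const b     = (p₀ ⊕ const b) +x· p₁
(p₀ +x· p₁) ⊕ (q₀ +x· q₁) = (p₀ ⊕ q₀) +x· (p₁ ⊕ q₁)

eval-⊕ : ∀ (p q : Poly k d) u → eval (p ⊕ q) u ≡ eval p u + eval q u
eval-⊕ (const a)   (const b)   u       = refl
eval-⊕ (const a)   (q₀ +x· q₁) (x ∷ u) =
  trans (cong (_+ toℤ x * eval q₁ u) (eval-⊕ (const a) q₀ u))
        (+-assoc a (eval q₀ u) (toℤ x * eval q₁ u))
eval-⊕ (p₀ +x· p₁) (const b)   (x ∷ u) =
  trans (cong (_+ toℤ x * eval p₁ u) (eval-⊕ p₀ (const b) u))
        (+-swap (eval p₀ u) b (toℤ x * eval p₁ u))
  where
  +-swap : ∀ a b c → a + b + c ≡ a + c + b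
  +-swap = solve-∀
eval-⊕ (p₀ +x· p₁) (q₀ +x· q₁) (x ∷ u) =
  trans (cong₂ (λ a b → a + toℤ x * b) (eval-⊕ p₀ q₀ u) (eval-⊕ p₁ q₁ u))
        (+-interchange (eval p₀ u) (eval q₀ u) (toℤ x) (eval p₁ u) (eval q₁ u))
  where
  +-interchange : ∀ a b x c d → a + b + x * (c + d) ≡ a + x * c + (b + x * d)
  +-interchange = solve-∀

_·_ : ℤ → Poly k d → Poly k d
a · const c   = const (a * c)
a · (p +x· q) = a · p +x· a · q

eval-· : ∀ a (p : Poly k d) u → eval (a · p) u ≡ a * eval p u
eval-· a (const c) u       = refl
eval-· a (p +x· q) (x ∷ u) =
  trans (cong₂ (λ b c → b + toℤ x * c) (eval-· a p u) (eval-· a q u))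
        (distrib a (eval p u) (toℤ x) (eval q u))
  where
  distrib : ∀ a b x c → a * b + x * (a * c) ≡ a * (b + x * c)
  distrib = solve-∀

lin : Vec ℤ k → Vec Bool k → ℤ
lin []       []      = 0ℤ
lin (a ∷ as) (x ∷ u) = a * toℤ x + lin as u

mulAffine : Poly k d → Vec ℤ k → ℤ → Poly k (suc d)
mulAffine (const c) []       b = const (c * b)
mulAffine (const c) (a ∷ as) b = mulAffine (const c) as b +x· const (c * a)
mulAffine (p +x· q) (a ∷ as) b = mulAffine p as b +x· (a · p ⊕ mulAffine q as (b + a))

eval-mulAffine : ∀ (p : Poly k d) as b u → eval (mulAffine p as b) u ≡ eval p u * (lin as u + b)
eval-mulAffine (const c) []       b []      = cong (c *_) (sym (+-identityˡ b))
eval-mulAffine (const c) (a ∷ as) b (x ∷ u) =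
  trans (cong (_+ toℤ x * (c * a)) (eval-mulAffine (const c) as b u))
        (distrib c a (toℤ x) (lin as u) b)
  where
  distrib : ∀ c a x l b → c * (l + b) + x * (c * a) ≡ c * (a * x + l + b)
  distrib = solve-∀
eval-mulAffine (p +x· q) (a ∷ as) b (x ∷ u) = begin
  eval (mulAffine p as b) u + X * eval (a · p ⊕ mulAffine q as (b + a)) u
    ≡⟨ cong₂ (λ e f → e + X * f) (eval-mulAffine p as b u)
             (trans (eval-⊕ (a · p) _ u) (cong₂ _+_ (eval-· a p u) (eval-mulAffine q as (b + a) u))) ⟩
  P * (ℓ + b) + X * (a * P + Q * (ℓ + (b + a)))
    ≡⟨ expand P Q X a ℓ b ⟩
  P * (ℓ + b) + X * (a * P + Q * (ℓ + b)) + X * (a * Q)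
    ≡⟨ cong (λ y → P * (ℓ + b) + X * (a * P + Q * (ℓ + b)) + y * (a * Q)) (toℤ-idem x) ⟨
  P * (ℓ + b) + X * (a * P + Q * (ℓ + b)) + X * X * (a * Q)
    ≡⟨ factor P Q X a ℓ b ⟩
  (P + X * Q) * (a * X + ℓ + b)
    ∎
  where
  X = toℤ x
  P = eval p u
  Q = eval q u
  ℓ = lin as u
  expand : ∀ P Q X a ℓ b → P * (ℓ + b) + X * (a * P + Q * (ℓ + (b + a)))
                         ≡ P * (ℓ + b) + X * (a * P + Q * (ℓ + b)) + X * (a * Q)
  expand = solve-∀
  factor : ∀ P Q X a ℓ b → P * (ℓ + b) + X * (a * P + Q * (ℓ + b)) + X * X * (a * Q)
                         ≡ (P + X * Q) * (a * X + ℓ + b)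
  factor = solve-∀

prodAffine : (Fin s → Vec ℤ k) → (Fin s → ℤ) → Poly k s
prodAffine {zero}  α β = const 1ℤ
prodAffine {suc s} α β = mulAffine (prodAffine (tail α) (tail β)) (α zero) (β zero)

eval-prodAffine : ∀ (α : Fin s → Vec ℤ k) β u →
                  eval (prodAffine α β) u ≡ product (λ t → lin (α t) u + β t)
eval-prodAffine {zero}  α β u = refl
eval-prodAffine {suc s} α β u = begin
  eval (mulAffine (prodAffine (tail α) (tail β)) (α zero) (β zero)) u
    ≡⟨ eval-mulAffine (prodAffine (tail α) (tail β)) (α zero) (β zero) u ⟩
  eval (prodAffine (tail α) (tail β)) u * (lin (α zero) u + β zero)
    ≡⟨ cong (_* (lin (α zero) u + β zero)) (eval-prodAffine (tail α) (tail β) u) ⟩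
  product (λ t → lin (α (suc t)) u + β (suc t)) * (lin (α zero) u + β zero)
    ≡⟨ *-comm (product (λ t → lin (α (suc t)) u + β (suc t))) _ ⟩
  product (λ t → lin (α t) u + β t)
    ∎

dim : ℕ → ℕ → ℕ
dim zero    d       = 1
dim (suc k) zero    = 1
dim (suc k) (suc d) = dim k (suc d) ℕ.+ dim k d

monomials : ∀ d → Vec Bool k → Vector ℤ (dim k d)
monomials d       []      = λ _ → 1ℤ
monomials zero    (x ∷ u) = λ _ → 1ℤ
monomials (suc d) (x ∷ u) = monomials (suc d) u ++ map (toℤ x *_) (monomials d u)

coeffs : Poly k d → Vector ℤ (dim k d)
coeffs {zero}          (const c) = λ _ → c
coeffs {suc k} {zero}  (const c) = λ _ → c
coeffs {suc k} {suc d} (const c) = coeffs {k} {suc d} (const c) ++ replicate (dim k d) 0ℤ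
coeffs                 (p +x· q) = coeffs p ++ coeffs q

dot-++-monomials : ∀ {k d} x (xs : Vector ℤ (dim k (suc d))) (ys : Vector ℤ (dim k d))
                   (u : Vec Bool k) →
                   dot (xs ++ ys) (monomials (suc d) (x ∷ u))
                     ≡ dot xs (monomials (suc d) u) + toℤ x * dot ys (monomials d u)
dot-++-monomials {k} {d} x xs ys u =
  trans (dot-++ xs _ ys _)
        (cong (_+_ (dot xs (monomials (suc d) u))) (dot-*ʳ (toℤ x) ys (monomials d u)))

eval≡dot-coeffs : ∀ (p : Poly k d) u → eval p u ≡ dot (coeffs p) (monomials d u)
eval≡dot-coeffs {zero}          (const c) []      = sym (trans (+-identityʳ (c * 1ℤ)) (*-identityʳ c))
eval≡dot-coeffs {suc k} {zero}  (const c) (x ∷ u) = sym (trans (+-identityʳ (c * 1ℤ)) (*-identityʳ c))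
eval≡dot-coeffs {suc k} {suc d} (const c) (x ∷ u) = sym (begin
  dot (coeffs {k} {suc d} (const c) ++ zeros) (monomials (suc d) (x ∷ u))
    ≡⟨ dot-++-monomials x (coeffs {k} {suc d} (const c)) zeros u ⟩
  dot (coeffs {k} {suc d} (const c)) (monomials (suc d) u) + toℤ x * dot zeros (monomials d u)
    ≡⟨ cong₂ (λ a b → a + toℤ x * b) (eval≡dot-coeffs {k} {suc d} (const c) u)
             (sym (sum-zero (λ t → *-zeroˡ (monomials d u t)))) ⟨
  c + toℤ x * 0ℤ
    ≡⟨ trans (cong (_+_ c) (*-zeroʳ (toℤ x))) (+-identityʳ c) ⟩
  c
    ∎)
  where
  zeros = replicate (dim k d) 0ℤ
eval≡dot-coeffs {suc k} {suc d} (p +x· q) (x ∷ u) = begin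
  eval p u + toℤ x * eval q u
    ≡⟨ cong₂ (λ a b → a + toℤ x * b) (eval≡dot-coeffs p u) (eval≡dot-coeffs q u) ⟩
  dot (coeffs p) (monomials (suc d) u) + toℤ x * dot (coeffs q) (monomials d u)
    ≡⟨ dot-++-monomials x (coeffs p) (coeffs q) u ⟨
  dot (coeffs p ++ coeffs q) (monomials (suc d) (x ∷ u))
    ∎

evaluations-independent⇒coeffs-independent :
  (p : Fin m → Poly k d) → (∀ κ → (∀ u → ∑[ i < m ] (κ i * eval (p i) u) ≡ 0ℤ) → ∀ i → κ i ≡ 0ℤ) →
  LinearlyIndependent (coeffs ∘ p)
evaluations-independent⇒coeffs-independent {m} {d = d} p independent κ combination≡0 =
  independent κ relation
  where
  relation : ∀ u → ∑[ i < m ] (κ i * eval (p i) u) ≡ 0ℤ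
  relation u = begin
    ∑[ i < m ] (κ i * eval (p i) u)
      ≡⟨ sum-cong-≗ (λ i → cong (κ i *_) (eval≡dot-coeffs (p i) u)) ⟩
    ∑[ i < m ] (κ i * dot (coeffs (p i)) e)
      ≡⟨ ∑-dot≡dot-combination κ (coeffs ∘ p) e ⟩
    dot (combination κ (coeffs ∘ p)) e
      ≡⟨ sum-zero (λ t → trans (cong (_* e t) (combination≡0 t)) (*-zeroˡ (e t))) ⟩
    0ℤ
      ∎
    where
    e = monomials d u

binomSum-zero : ∀ d → binomSum 0 d ≡ 1
binomSum-zero zero    = refl
binomSum-zero (suc d) = trans (ℕ.+-identityʳ (binomSum 0 d)) (binomSum-zero d)

binomSum-pascal : ∀ k d → binomSum (suc k) (suc d) ≡ binomSum k (suc d) ℕ.+ binomSum k d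
binomSum-pascal k zero    = trans (cong (1 ℕ.+_) (sym (nCk+nC[k+1]≡[n+1]C[k+1] k 0))) (ℕ.+-comm 1 _)
binomSum-pascal k (suc d) = begin
  binomSum (suc k) (suc d) ℕ.+ suc k C suc (suc d)
    ≡⟨ cong₂ ℕ._+_ (binomSum-pascal k d) (sym (nCk+nC[k+1]≡[n+1]C[k+1] k (suc d))) ⟩
  (binomSum k (suc d) ℕ.+ binomSum k d) ℕ.+ (k C suc d ℕ.+ k C suc (suc d))
    ≡⟨ regroup (binomSum k (suc d)) (binomSum k d) (k C suc d) (k C suc (suc d)) ⟩
  (binomSum k (suc d) ℕ.+ k C suc (suc d)) ℕ.+ (binomSum k d ℕ.+ k C suc d)
    ∎
  where
  regroup : ∀ a b c d → (a ℕ.+ b) ℕ.+ (c ℕ.+ d) ≡ (a ℕ.+ d) ℕ.+ (b ℕ.+ c)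
  regroup = ℕ-Solver.solve-∀

dim≡binomSum : ∀ k d → dim k d ≡ binomSum k d
dim≡binomSum zero    d       = sym (binomSum-zero d)
dim≡binomSum (suc k) zero    = refl
dim≡binomSum (suc k) (suc d) =
  trans (cong₂ ℕ._+_ (dim≡binomSum k (suc d)) (dim≡binomSum k d)) (sym (binomSum-pascal k d))

lin-toℤ : ∀ (v w : Subset k) → lin (Vec.map toℤ v) w ≡ + ∣ v ∩ w ∣
lin-toℤ []          []          = refl
lin-toℤ (true ∷ v)  (true ∷ w)  = cong (λ i → 1ℤ + i) (lin-toℤ v w)
lin-toℤ (true ∷ v)  (false ∷ w) = trans (+-identityˡ (lin (Vec.map toℤ v) w)) (lin-toℤ v w)
lin-toℤ (false ∷ v) (y ∷ w)     = trans (+-identityˡ (lin (Vec.map toℤ v) w)) (lin-toℤ v w)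

∣∷∩∷∣ : ∀ {x y} (v w : Subset k) → x ≤ᴮ y → + ∣ (x ∷ v) ∩ (y ∷ w) ∣ ≡ toℤ x + + ∣ v ∩ w ∣
∣∷∩∷∣             v w f≤t = refl
∣∷∩∷∣ {x = false} v w b≤b = refl
∣∷∩∷∣ {x = true}  v w b≤b = refl

setPoly : (Fin s → ℕ) → Subset (suc k) → Poly k s
setPoly L (x ∷ v) = prodAffine (λ _ → Vec.map toℤ v) (λ t → toℤ x - + L t)

eval-setPoly : ∀ (L : Fin s → ℕ) (a b : Subset (suc k)) → Vec.head a ≤ᴮ Vec.head b →
               eval (setPoly L a) (Vec.tail b) ≡ product (λ t → + ∣ a ∩ b ∣ - + L t)
eval-setPoly L (x ∷ v) (y ∷ w) x≤y = begin
  eval (setPoly L (x ∷ v)) w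
    ≡⟨ eval-prodAffine (λ _ → Vec.map toℤ v) (λ t → toℤ x - + L t) w ⟩
  product (λ t → lin (Vec.map toℤ v) w + (toℤ x - + L t))
    ≡⟨ product-cong-≗ factor ⟩
  product (λ t → + ∣ (x ∷ v) ∩ (y ∷ w) ∣ - + L t)
    ∎
  where
  regroup : ∀ c x l → c + (x - l) ≡ x + c - l
  regroup = solve-∀
  factor : ∀ t → lin (Vec.map toℤ v) w + (toℤ x - + L t) ≡ + ∣ (x ∷ v) ∩ (y ∷ w) ∣ - + L t
  factor t = begin
    lin (Vec.map toℤ v) w + (toℤ x - + L t)  ≡⟨ cong (_+ (toℤ x - + L t)) (lin-toℤ v w) ⟩
    + ∣ v ∩ w ∣ + (toℤ x - + L t)            ≡⟨ regroup (+ ∣ v ∩ w ∣) (toℤ x) (+ L t) ⟩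
    toℤ x + + ∣ v ∩ w ∣ - + L t              ≡⟨ cong (_- + L t) (∣∷∩∷∣ v w x≤y) ⟨
    + ∣ (x ∷ v) ∩ (y ∷ w) ∣ - + L t          ∎

eval-setPoly-self≢0 : ∀ (L : Fin s → ℕ) (a : Subset (suc k)) → ¬ ∣ a ∣ ∈L L →
                      eval (setPoly L a) (Vec.tail a) ≢ 0ℤ
eval-setPoly-self≢0 L a ∣a∣∉L =
  subst (_≢ 0ℤ) (sym (eval-setPoly L a a ≤-refl)) (product≢0 _ factor≢0)
  where
  factor≢0 : ∀ t → + ∣ a ∩ a ∣ - + L t ≢ 0ℤ
  factor≢0 t eq rewrite ∩-idem a = ∣a∣∉L (t , +-injective (i-j≡0⇒i≡j _ _ eq))

eval-setPoly-other≡0 : ∀ (L : Fin s → ℕ) (a b : Subset (suc k)) → ∣ a ∩ b ∣ ∈L L →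
                       Vec.head a ≤ᴮ Vec.head b → eval (setPoly L a) (Vec.tail b) ≡ 0ℤ
eval-setPoly-other≡0 L a b (t , ∣a∩b∣≡Lt) ha≤hb =
  trans (eval-setPoly L a b ha≤hb)
        (product≡0 _ t (trans (cong (λ n → + n - + L t) ∣a∩b∣≡Lt) (+-inverseʳ (+ L t))))

module _ (L : Fin s → ℕ) (A : Fin m → Subset (suc k))
         (intersections : ∀ i j → i ≢ j → ∣ A i ∩ A j ∣ ∈L L)
         (sizes : ∀ i → ¬ ∣ A i ∣ ∈L L) where

  private
    f : Fin m → Poly k s
    f = setPoly L ∘ A

  setPolys-independent : ∀ κ → (∀ u → ∑[ i < m ] (κ i * eval (f i) u) ≡ 0ℤ) → ∀ j → κ j ≡ 0ℤ
  setPolys-independent κ annihilating = κ≡0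
    where
    κⱼ≡0 : ∀ j → (∀ i → Vec.head (A i) ≤ᴮ Vec.head (A j) ⊎ κ i ≡ 0ℤ) → κ j ≡ 0ℤ
    κⱼ≡0 j settled = sum≡0⇒coefficient≡0 κ (λ i → eval (f i) uⱼ) j
                       (annihilating uⱼ) (eval-setPoly-self≢0 L (A j) (sizes j)) term≡0
      where
      uⱼ = Vec.tail (A j)
      term≡0 : ∀ i → i ≢ j → κ i * eval (f i) uⱼ ≡ 0ℤ
      term≡0 i i≢j with settled i
      ... | inj₁ hᵢ≤hⱼ =
        trans (cong (κ i *_) (eval-setPoly-other≡0 L (A i) (A j) (intersections i j i≢j) hᵢ≤hⱼ))
              (*-zeroʳ (κ i))
      ... | inj₂ κᵢ≡0  = trans (cong (_* eval (f i) uⱼ) κᵢ≡0) (*-zeroˡ (eval (f i) uⱼ))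

    containing-first : ∀ j → Vec.head (A j) ≡ true → κ j ≡ 0ℤ
    containing-first j hⱼ≡true =
      κⱼ≡0 j λ i → inj₁ (subst (Vec.head (A i) ≤ᴮ_) (sym hⱼ≡true) (≤-maximum _))

    κ≡0 : ∀ j → κ j ≡ 0ℤ
    κ≡0 j = κⱼ≡0 j settled
      where
      settled : ∀ i → Vec.head (A i) ≤ᴮ Vec.head (A j) ⊎ κ i ≡ 0ℤ
      settled i with Vec.head (A i) in hᵢ
      ... | true  = inj₂ (containing-first i hᵢ)
      ... | false = inj₁ (≤-minimum _)

  family-bound : m ≤ binomSum k s
  family-bound = subst (m ≤_) (dim≡binomSum k s)
    (independent⇒size≤dim (coeffs ∘ f)
      (evaluations-independent⇒coeffs-independent f setPolys-independent))

-- For n = 0 a point lying in no A i is added, which changes no cardinality.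
corollary2p8 : (n s m : ℕ) (L : Fin s → ℕ) → StrictlyIncreasing L
    → (A : Fin m → Subset n) → Injective _≡_ _≡_ A
    → (∀ i j → ¬ i ≡ j → ∣ A i ∩ A j ∣ ∈L L)
    → (∀ i → ¬ (∣ A i ∣ ∈L L))
    → m ≤ binomSum (n ∸ 1) s
corollary2p8 zero    s m L _ A _ intersections sizes =
  family-bound L (λ i → false ∷ A i) intersections sizes
corollary2p8 (suc n) s m L _ A _ intersections sizes = family-bound L A intersections sizes
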